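{- Let $\mathfrak{F}$ be a CI frame closed under copying, marginalization, and tight replication. Then for every finite set $N$ with $|N|\ge1$, every model $\mathcal{M}\in\mathfrak{F}(N)$ is self-adhesive relative to $\mathfrak{F}$ at every set $L\subseteq N$ with $|L|=|N|-1$.
   Context: For a finite set $N$, $\mathbb{S}(N)$ denotes the set of all CI statements $ij|K$ with $i,j\in N$ distinct and $K\subseteq N\setminus\{i,j\}$, with $ij|K$ and $ji|K$ identified; juxtaposition denotes union. A CI model over $N$ is a subset of $\mathbb{S}(N)$. A CI frame $\mathfrak{F}$ assigns to every finite set $N$ a set $\mathfrak{F}(N)$ of models over $N$ with $\mathbb{S}(N)\in\mathfrak{F}(N)$. A bijection $\varphi:N\to M$ acts by $\varphi(ij|K)=\varphi(i)\varphi(j)|\varphi(K)$; closed under copying: $\mathcal{M}\in\mathfrak{F}(N)\Rightarrow\varphi(\mathcal{M})\in\mathfrak{F}(M)$. Marginal: $\mathcal{M}^{\downarrow M}=\mathcal{M}\cap\mathbb{S}(M)$; closed under marginalization if marginals of members are members. For pairwise disjoint $I,J,C$, $I\perp J\,|\,C\,[\mathcal{M}]$ means $ij|L'\in\mathcal{M}$ for all $i\in I$, $j\in J$, $C\subseteq L'\subseteq(I\cup J\cup C)\setminus\{i,j\}$. Tight replication: for finite $N,M$ with $|N|=|M|=n\ge1$ and $|N\cap M|=n-1$, put $L=N\cap M$, $u$ the element of $N\setminus L$, $v$ the element of $M\setminus L$, $\rho:N\cup M\to N$ with $\rho|_N=\mathrm{id}$, $\rho(v)=u$. For $\mathcal{M}\subseteq\mathbb{S}(N)$,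 $\mathcal{M}_{v\|u}\subseteq\mathbb{S}(N\cup M)$ consists of those $ij|K$ with $\rho(i)\perp\rho(j)\,|\,\rho(K)\,[\mathcal{M}]$, under the conventions: $a\perp b\,|\,C\,[\mathcal{M}]$ holds whenever $\{a,b\}\cap C\ne\emptyset$; for $C\subseteq L$, $u\perp u\,|\,C\,[\mathcal{M}]$ means $\{u\}\perp(L\setminus C)\,|\,C\,[\mathcal{M}]$; otherwise it means $\rho(i)\rho(j)|\rho(K)\in\mathcal{M}$. $\mathfrak{F}$ is closed under tight replication if $\mathcal{M}\in\mathfrak{F}(N)$ implies $\mathcal{M}_{v\|u}\in\mathfrak{F}(N\cup M)$ for all such $N,M$. $\mathcal{M}\in\mathfrak{F}(N)$ is self-adhesive at $L\subseteq N$ relative to $\mathfrak{F}$ if for every bijection $\varphi:N\to M$ with $N\cap M=L$ and $\varphi|_L=\mathrm{id}_L$ there is $\mathcal{Z}\in\mathfrak{F}(N\cup M)$ with $\mathcal{Z}^{\downarrow N}=\mathcal{M}$, $\mathcal{Z}^{\downarrow M}=\varphi(\mathcal{M})$, and $(N\setminus M)\perp(M\setminus N)\,|\,L\,[\mathcal{Z}]$. -}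

module Defs where

open import Data.Nat using (ℕ; _≟_)
open import Data.List using (List; []; _∷_; map; filter; _++_)
open import Data.List.Membership.Propositional using (_∈_; _∉_)
open import Data.List.Membership.DecPropositional _≟_ using (_∈?_)
open import Data.Product using (Σ; _×_; _,_)
open import Data.Sum using (_⊎_)
open import Data.Bool using (if_then_else_)
open import Relation.Nullary using (¬_; ¬?; does)
open import Relation.Binary.PropositionalEquality using (_≡_; _≢_)
open import Function.Bundles using (_⇔_)

-- A finite set is
-- represented by a list of naturals; two lists represent the same set
-- when they have the same members (duplicates / order are irrelevant).

Elem : Set
Elem = ℕ

FinSet : Set
FinSet = List Elem

_∼_ : FinSet → FinSet → Set
A ∼ B = ∀ x → (x ∈ A) ⇔ (x ∈ B)

_⊆_ : FinSet → FinSet → Set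
A ⊆ B = ∀ x → x ∈ A → x ∈ B

_∖_ : FinSet → FinSet → FinSet
A ∖ B = filter (λ x → ¬? (x ∈? B)) A

-- (the union of N and M is the list  N ++ M)

-- CI statements  ij|K  (as raw triples; ij|K and ji|K are identified
-- through the equivalence _≈S_ below, and K is a set).

record Stmt : Set where
  constructor st
  field
    i : Elem
    j : Elem
    K : FinSet

open Stmt public

_≈S_ : Stmt → Stmt → Set
st i j K ≈S st i' j' K' =
  ((i ≡ i' × j ≡ j') ⊎ (i ≡ j' × j ≡ i')) × (K ∼ K')

InS : FinSet → Stmt → Set
InS N (st i j K) =
  i ∈ N × j ∈ N × i ≢ j × (∀ x → x ∈ K → x ∈ N × x ≢ i × x ≢ j)

Model : Set₁
Model = Stmt → Set

𝕊 : FinSet → Model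
𝕊 N = InS N

_≐_ : Model → Model → Set
A ≐ B = ∀ s → A s ⇔ B s

IsModelOver : FinSet → Model → Set
IsModelOver N 𝓜 =
  (∀ s → 𝓜 s → InS N s) × (∀ s t → s ≈S t → 𝓜 s → 𝓜 t)

_↓_ : Model → FinSet → Model
(𝓜 ↓ M) s = 𝓜 s × InS M s

mapS : (Elem → Elem) → Stmt → Stmt
mapS φ (st i j K) = st (φ i) (φ j) (map φ K)

copy : (Elem → Elem) → Model → Model
copy φ 𝓜 s = Σ Stmt λ t → 𝓜 t × (mapS φ t ≈S s)

IsBij : (Elem → Elem) → FinSet → FinSet → Set
IsBij φ N M =
  (∀ x → x ∈ N → φ x ∈ M)
  × (∀ x y → x ∈ N → y ∈ N → φ x ≡ φ y → x ≡ y)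
  × (∀ y → y ∈ M → Σ Elem λ x → x ∈ N × φ x ≡ y)

Indep : Model → FinSet → FinSet → FinSet → Set
Indep 𝓜 I J C =
  ∀ a b (L' : FinSet) → a ∈ I → b ∈ J → C ⊆ L' →
  (∀ x → x ∈ L' → (x ∈ I ⊎ x ∈ J ⊎ x ∈ C) × x ≢ a × x ≢ b) →
  𝓜 (st a b L')

-- Tight replication  𝓜_{v‖u}  over the ground set U = N ∪ M,
-- with L = N ∩ M, N = L ∪ {u}, M = L ∪ {v}.

ρ : Elem → Elem → Elem → Elem
ρ u v x = if does (x ≟ v) then u else x

RepCond : FinSet → Elem → Elem → Model → Stmt → Set
RepCond L u v 𝓜 (st i j K) =
  -- {a,b} ∩ C ≠ ∅  : holds
  (ρ u v i ∈ map (ρ u v) K ⊎ ρ u v j ∈ map (ρ u v) K)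
  -- a = b (= u), C ⊆ L : {u} ⊥ (L \ C) | C
  ⊎ (ρ u v i ≡ u × ρ u v j ≡ u × map (ρ u v) K ⊆ L
       × Indep 𝓜 (u ∷ []) (L ∖ map (ρ u v) K) (map (ρ u v) K))
  ⊎ (ρ u v i ≢ ρ u v j × 𝓜 (st (ρ u v i) (ρ u v j) (map (ρ u v) K)))

replicate : FinSet → FinSet → Elem → Elem → Model → Model
replicate U L u v 𝓜 s = InS U s × RepCond L u v 𝓜 s

record CIFrame : Set₂ where
  field
    𝔉 : FinSet → Model → Set₁
    models : ∀ N 𝓜 → 𝔉 N 𝓜 → IsModelOver N 𝓜
    -- 𝔉(N) is a set of sets: membership is extensional
    extensional : ∀ N 𝓜 𝓝 → 𝔉 N 𝓜 → 𝓜 ≐ 𝓝 → 𝔉 N 𝓝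
    full : ∀ N → 𝔉 N (𝕊 N)

open CIFrame public

ClosedUnderCopying : CIFrame → Set₁
ClosedUnderCopying 𝔽 =
  ∀ N M φ → IsBij φ N M → ∀ 𝓜 → 𝔉 𝔽 N 𝓜 → 𝔉 𝔽 M (copy φ 𝓜)

ClosedUnderMarginalization : CIFrame → Set₁
ClosedUnderMarginalization 𝔽 =
  ∀ N M 𝓜 → M ⊆ N → 𝔉 𝔽 N 𝓜 → 𝔉 𝔽 M (𝓜 ↓ M)

-- |N| = |M| = n ≥ 1, |N ∩ M| = n - 1 is written out as
-- N = L ∪ {u}, M = L ∪ {v}, u, v ∉ L, u ≠ v.
ClosedUnderTightReplication : CIFrame → Set₁
ClosedUnderTightReplication 𝔽 =
  ∀ N M L u v → u ∉ L → v ∉ L → u ≢ v →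
  N ∼ (u ∷ L) → M ∼ (v ∷ L) →
  ∀ 𝓜 → 𝔉 𝔽 N 𝓜 → 𝔉 𝔽 (N ++ M) (replicate (N ++ M) L u v 𝓜)

SelfAdhesiveAt : CIFrame → FinSet → Model → FinSet → Set₁
SelfAdhesiveAt 𝔽 N 𝓜 L =
  ∀ (M : FinSet) (φ : Elem → Elem) → IsBij φ N M →
  (∀ x → (x ∈ N × x ∈ M) ⇔ x ∈ L) →
  (∀ x → x ∈ L → φ x ≡ x) →
  Σ Model λ 𝓩 →
    𝔉 𝔽 (N ++ M) 𝓩
    × ((𝓩 ↓ N) ≐ 𝓜)
    × ((𝓩 ↓ M) ≐ copy φ 𝓜)
    × Indep 𝓩 (N ∖ M) (M ∖ N) L

{-# OPTIONS --safe #-}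
module Submission where

-- Put v = φ u, so that N ∪ M = L ∪ {u, v} and the tight replication 𝓜_{v‖u}
-- lives on N ∪ M.  The map ρ (v ↦ u) is the identity on N and inverse to φ
-- on M, so the marginals of 𝓜_{v‖u} on N and on M are the copies of 𝓜 along
-- id and along φ.  Every statement u v | L' with L' ∼ L is in 𝓜_{v‖u}: ρ
-- sends it to u u | L, which by convention means {u} ⊥ ∅ | L [𝓜] and holds
-- vacuously.  This is (N ∖ M) ⊥ (M ∖ N) | L.

open import Defs
open import Data.Nat using (_≟_)
open import Data.Bool using (if_then_else_)
open import Data.List using ([]; _∷_; map; _++_)
open import Data.List.Properties using (map-id; map-id-local; map-∘)
import Data.List.Relation.Unary.All as All
open import Data.List.Relation.Unary.Any using (here; there)
open import Data.List.Membership.Propositional using (_∈_; _∉_)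
open import Data.List.Membership.DecPropositional _≟_ using (_∈?_)
open import Data.List.Membership.Propositional.Properties
  using (∈-map⁺; ∈-map⁻; ∈-++⁺ˡ; ∈-++⁺ʳ; ∈-filter⁻)
open import Data.Product using (Σ; _×_; _,_; proj₁; proj₂)
open import Data.Sum using (_⊎_; inj₁; inj₂; [_,_]′)
open import Data.Empty using (⊥-elim)
open import Relation.Nullary using (¬?)
open import Relation.Nullary.Decidable using (dec-true; dec-false)
open import Relation.Binary.PropositionalEquality
  using (_≡_; _≢_; refl; sym; trans; cong; subst)
open import Function using (id)
open import Function.Bundles using (_⇔_; mk⇔; Equivalence)
import Function.Properties.Equivalence as ⇔

open Equivalence using (to; from)

∼-refl : ∀ {A} → A ∼ A
∼-refl _ = ⇔.refl

∼-trans : ∀ {A B C} → A ∼ B → B ∼ C → A ∼ C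
∼-trans A∼B B∼C x = ⇔.trans (A∼B x) (B∼C x)

≡⇒∼ : ∀ {A B} → A ≡ B → A ∼ B
≡⇒∼ refl = ∼-refl

∼-map⁺ : ∀ (f : Elem → Elem) {A B} → A ∼ B → map f A ∼ map f B
∼-map⁺ f A∼B y = mk⇔ (image A∼B) (image (λ x → ⇔.sym (A∼B x)))
  where
  image : ∀ {A B} → A ∼ B → y ∈ map f A → y ∈ map f B
  image A∼B y∈fA with ∈-map⁻ f y∈fA
  ... | x , x∈A , refl = ∈-map⁺ f (to (A∼B x) x∈A)

map-inverse-local : ∀ {f g : Elem → Elem} {A} →
                    (∀ {x} → x ∈ A → g (f x) ≡ x) → map g (map f A) ≡ A
map-inverse-local {A = A} gf≡id = trans (sym (map-∘ A)) (map-id-local (All.tabulate gf≡id))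

∖-⊆-singleton : ∀ {A B C a} → (∀ {x} → x ∈ A → x ≡ a ⊎ x ∈ C) → C ⊆ B →
                (A ∖ B) ⊆ (a ∷ [])
∖-⊆-singleton {B = B} A⊆a∷C C⊆B x x∈A∖B with ∈-filter⁻ (λ y → ¬? (y ∈? B)) x∈A∖B
... | x∈A , x∉B with A⊆a∷C x∈A
...   | inj₁ x≡a = here x≡a
...   | inj₂ x∈C = ⊥-elim (x∉B (C⊆B x x∈C))

≐-trans : ∀ {𝓐 𝓑 𝓒} → 𝓐 ≐ 𝓑 → 𝓑 ≐ 𝓒 → 𝓐 ≐ 𝓒
≐-trans 𝓐≐𝓑 𝓑≐𝓒 s = ⇔.trans (𝓐≐𝓑 s) (𝓑≐𝓒 s)

ρ-v≡u : ∀ u v → ρ u v v ≡ u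
ρ-v≡u u v = cong (if_then u else v) (dec-true (v ≟ v) refl)

x≢v⇒ρx≡x : ∀ u {v x} → x ≢ v → ρ u v x ≡ x
x≢v⇒ρx≡x u {v} {x} x≢v = cong (if_then u else x) (dec-false (x ≟ v) x≢v)

v∉A⇒ρ-id-on : ∀ u {v A x} → v ∉ A → x ∈ A → ρ u v x ≡ x
v∉A⇒ρ-id-on u v∉A x∈A = x≢v⇒ρx≡x u (λ { refl → v∉A x∈A })

InS-mono : ∀ {A B} s → A ⊆ B → InS A s → InS B s
InS-mono (st i j K) A⊆B (i∈A , j∈A , i≢j , K-ok) =
  A⊆B i i∈A , A⊆B j j∈A , i≢j ,
  λ x x∈K → let x∈A , x≢i , x≢j = K-ok x x∈K in A⊆B x x∈A , x≢i , x≢j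

InS-resp-≈S : ∀ {A} s t → s ≈S t → InS A s → InS A t
InS-resp-≈S (st i j K) (st _ _ K') (inj₁ (refl , refl) , K∼K') (i∈ , j∈ , i≢j , K-ok) =
  i∈ , j∈ , i≢j , λ x x∈K' → K-ok x (from (K∼K' x) x∈K')
InS-resp-≈S (st i j K) (st _ _ K') (inj₂ (refl , refl) , K∼K') (i∈ , j∈ , i≢j , K-ok) =
  j∈ , i∈ , (λ j≡i → i≢j (sym j≡i)) ,
  λ x x∈K' → let x∈A , x≢i , x≢j = K-ok x (from (K∼K' x) x∈K') in x∈A , x≢j , x≢i

InS-mapS : ∀ {A B f} s → (∀ x → x ∈ A → f x ∈ B) →
           (∀ x y → x ∈ A → y ∈ A → f x ≡ f y → x ≡ y) →
           InS A s → InS B (mapS f s)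
InS-mapS {B = B} {f} (st i j K) f-maps f-inj (i∈ , j∈ , i≢j , K-ok) =
  f-maps i i∈ , f-maps j j∈ , (λ fi≡fj → i≢j (f-inj i j i∈ j∈ fi≡fj)) , fK-ok
  where
  fK-ok : ∀ y → y ∈ map f K → y ∈ B × y ≢ f i × y ≢ f j
  fK-ok y y∈fK with ∈-map⁻ f y∈fK
  ... | k , k∈K , refl =
    let k∈A , k≢i , k≢j = K-ok k k∈K
    in f-maps k k∈A , (λ fk≡fi → k≢i (f-inj k i k∈A i∈ fk≡fi)) ,
                      (λ fk≡fj → k≢j (f-inj k j k∈A j∈ fk≡fj))

copy-id : ∀ {𝓜} → (∀ s t → s ≈S t → 𝓜 s → 𝓜 t) → copy id 𝓜 ≐ 𝓜
copy-id {𝓜} 𝓜-resp-≈S (st i j K) = mk⇔ forth back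
  where
  forth : copy id 𝓜 (st i j K) → 𝓜 (st i j K)
  forth (t@(st _ _ K₀) , m , ij≈ , K₀∼K) =
    𝓜-resp-≈S t _ (ij≈ , ∼-trans (≡⇒∼ (sym (map-id K₀))) K₀∼K) m
  back : 𝓜 (st i j K) → copy id 𝓜 (st i j K)
  back m = st i j K , m , inj₁ (refl , refl) , ≡⇒∼ (map-id K)

Indep-antimono : ∀ {𝓜 I I' J J' C} → I ⊆ I' → J ⊆ J' → Indep 𝓜 I' J' C → Indep 𝓜 I J C
Indep-antimono {I' = I'} {J' = J'} {C} I⊆I' J⊆J' indep a b L' a∈I b∈J C⊆L' L'-ok =
  indep a b L' (I⊆I' a a∈I) (J⊆J' b b∈J) C⊆L' widen
  where
  widen : ∀ x → x ∈ L' → (x ∈ I' ⊎ x ∈ J' ⊎ x ∈ C) × x ≢ a × x ≢ b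
  widen x x∈L' with L'-ok x x∈L'
  ... | inj₁ x∈I , x≢a , x≢b = inj₁ (I⊆I' x x∈I) , x≢a , x≢b
  ... | inj₂ (inj₁ x∈J) , x≢a , x≢b = inj₂ (inj₁ (J⊆J' x x∈J)) , x≢a , x≢b
  ... | inj₂ (inj₂ x∈C) , x≢a , x≢b = inj₂ (inj₂ x∈C) , x≢a , x≢b

Indep-singleton : ∀ {𝓜 a b C} → (∀ L' → C ⊆ L' → L' ⊆ C → 𝓜 (st a b L')) →
                  Indep 𝓜 (a ∷ []) (b ∷ []) C
Indep-singleton {C = C} a⊥b _ _ L' (here refl) (here refl) C⊆L' L'-ok = a⊥b L' C⊆L' L'⊆C
  where
  L'⊆C : L' ⊆ C
  L'⊆C x x∈L' with L'-ok x x∈L'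
  ... | inj₁ (here x≡a) , x≢a , _ = ⊥-elim (x≢a x≡a)
  ... | inj₂ (inj₁ (here x≡b)) , _ , x≢b = ⊥-elim (x≢b x≡b)
  ... | inj₂ (inj₂ x∈C) , _ , _ = x∈C

Indep-vacuous : ∀ {𝓜 I J C} → (∀ x → x ∉ J) → Indep 𝓜 I J C
Indep-vacuous J-empty _ b _ _ b∈J = ⊥-elim (J-empty b b∈J)

module _ {U L N M : FinSet} {u v : Elem} {𝓜 : Model} {φ : Elem → Elem}
         (𝓜-over-N : IsModelOver N 𝓜) (M⊆U : M ⊆ U)
         (φ-maps : ∀ x → x ∈ N → φ x ∈ M)
         (ρφ≡id : ∀ x → x ∈ N → ρ u v (φ x) ≡ x)
         (φρ≡id : ∀ y → y ∈ M → φ (ρ u v y) ≡ y) where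

  private
    𝓩 : Model
    𝓩 = replicate U L u v 𝓜

    𝓜-resp-≈S : ∀ s t → s ≈S t → 𝓜 s → 𝓜 t
    𝓜-resp-≈S = proj₂ 𝓜-over-N

    φ-injective : ∀ x y → x ∈ N → y ∈ N → φ x ≡ φ y → x ≡ y
    φ-injective x y x∈N y∈N φx≡φy =
      trans (sym (ρφ≡id x x∈N)) (trans (cong (ρ u v) φx≡φy) (ρφ≡id y y∈N))

    ρ-injective : ∀ x y → x ∈ M → y ∈ M → ρ u v x ≡ ρ u v y → x ≡ y
    ρ-injective x y x∈M y∈M ρx≡ρy =
      trans (sym (φρ≡id x x∈M)) (trans (cong φ ρx≡ρy) (φρ≡id y y∈M))

    ρ-∉-image : ∀ {i K} → i ∈ M → (∀ k → k ∈ K → k ∈ M × k ≢ i) →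
                ρ u v i ∉ map (ρ u v) K
    ρ-∉-image {i} i∈M K-ok ρi∈ρK with ∈-map⁻ (ρ u v) ρi∈ρK
    ... | k , k∈K , ρi≡ρk =
      let k∈M , k≢i = K-ok k k∈K in k≢i (sym (ρ-injective i k i∈M k∈M ρi≡ρk))

    marginal⇒copy : ∀ s → (𝓩 ↓ M) s → copy φ 𝓜 s
    marginal⇒copy (st i j K) ((_ , inj₁ (inj₁ ρi∈ρK)) , i∈M , _ , _ , K-ok) =
      ⊥-elim (ρ-∉-image i∈M (λ k k∈K → let k∈M , k≢i , _ = K-ok k k∈K in k∈M , k≢i) ρi∈ρK)
    marginal⇒copy (st i j K) ((_ , inj₁ (inj₂ ρj∈ρK)) , _ , j∈M , _ , K-ok) =
      ⊥-elim (ρ-∉-image j∈M (λ k k∈K → let k∈M , _ , k≢j = K-ok k k∈K in k∈M , k≢j) ρj∈ρK)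
    marginal⇒copy (st i j K) ((_ , inj₂ (inj₁ (ρi≡u , ρj≡u , _))) , i∈M , j∈M , i≢j , _) =
      ⊥-elim (i≢j (ρ-injective i j i∈M j∈M (trans ρi≡u (sym ρj≡u))))
    marginal⇒copy (st i j K) ((_ , inj₂ (inj₂ (_ , m))) , i∈M , j∈M , _ , K-ok) =
      st (ρ u v i) (ρ u v j) (map (ρ u v) K) , m , inj₁ (φρ≡id i i∈M , φρ≡id j j∈M) ,
      ≡⇒∼ (map-inverse-local (λ {k} k∈K → φρ≡id k (proj₁ (K-ok k k∈K))))

    image-in-marginal : ∀ {a b C K} → 𝓜 (st a b C) → map φ C ∼ K →
                        (𝓩 ↓ M) (st (φ a) (φ b) K)
    image-in-marginal {a} {b} {C} {K} m φC∼K with proj₁ 𝓜-over-N _ m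
    ... | InS-N@(a∈N , b∈N , a≢b , C-ok) =
      (InS-mono _ M⊆U InS-M , inj₂ (inj₂ (ρφa≢ρφb , ρφab|ρK∈𝓜))) , InS-M
      where
      InS-M : InS M (st (φ a) (φ b) K)
      InS-M = InS-resp-≈S _ _ (inj₁ (refl , refl) , φC∼K)
                (InS-mapS (st a b C) φ-maps φ-injective InS-N)
      ρφa≢ρφb : ρ u v (φ a) ≢ ρ u v (φ b)
      ρφa≢ρφb e = a≢b (trans (sym (ρφ≡id a a∈N)) (trans e (ρφ≡id b b∈N)))
      ρφC≡C : map (ρ u v) (map φ C) ≡ C
      ρφC≡C = map-inverse-local (λ {c} c∈C → ρφ≡id c (proj₁ (C-ok c c∈C)))
      C∼ρK : C ∼ map (ρ u v) K
      C∼ρK = ∼-trans (≡⇒∼ (sym ρφC≡C)) (∼-map⁺ (ρ u v) φC∼K)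
      ρφab|ρK∈𝓜 : 𝓜 (st (ρ u v (φ a)) (ρ u v (φ b)) (map (ρ u v) K))
      ρφab|ρK∈𝓜 = 𝓜-resp-≈S _ _ (inj₁ (sym (ρφ≡id a a∈N) , sym (ρφ≡id b b∈N)) , C∼ρK) m

    copy⇒marginal : ∀ s → copy φ 𝓜 s → (𝓩 ↓ M) s
    copy⇒marginal (st _ _ K) (st a b C , m , inj₁ (refl , refl) , φC∼K) =
      image-in-marginal m φC∼K
    copy⇒marginal (st _ _ K) (st a b C , m , inj₂ (refl , refl) , φC∼K) =
      image-in-marginal (𝓜-resp-≈S _ (st b a C) (inj₂ (refl , refl) , ∼-refl) m) φC∼K

  replicate↓≐copy : (replicate U L u v 𝓜 ↓ M) ≐ copy φ 𝓜
  replicate↓≐copy s = mk⇔ (marginal⇒copy s) (copy⇒marginal s)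

replicate-u⊥v : ∀ {U L u v 𝓜} → u ∈ U → v ∈ U → u ≢ v → u ∉ L → v ∉ L → L ⊆ U →
                ∀ L' → L ⊆ L' → L' ⊆ L → replicate U L u v 𝓜 (st u v L')
replicate-u⊥v {U} {L} {u} {v} u∈U v∈U u≢v u∉L v∉L L⊆U L' L⊆L' L'⊆L =
  (u∈U , v∈U , u≢v , L'-ok) ,
  inj₂ (inj₁ (x≢v⇒ρx≡x u u≢v , ρ-v≡u u v , ρL'⊆L , Indep-vacuous nothing-left))
  where
  L'-ok : ∀ x → x ∈ L' → x ∈ U × x ≢ u × x ≢ v
  L'-ok x x∈L' =
    L⊆U x (L'⊆L x x∈L') , (λ { refl → u∉L (L'⊆L x x∈L') }) , (λ { refl → v∉L (L'⊆L x x∈L') })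
  ρL'≡L' : map (ρ u v) L' ≡ L'
  ρL'≡L' = map-id-local (All.tabulate (λ {x} x∈L' → v∉A⇒ρ-id-on u v∉L (L'⊆L x x∈L')))
  ρL'⊆L : map (ρ u v) L' ⊆ L
  ρL'⊆L x x∈ρL' = L'⊆L x (subst (x ∈_) ρL'≡L' x∈ρL')
  nothing-left : ∀ x → x ∉ L ∖ map (ρ u v) L'
  nothing-left x x∈L∖ρL' with ∈-filter⁻ (λ y → ¬? (y ∈? map (ρ u v) L')) x∈L∖ρL'
  ... | x∈L , x∉ρL' = x∉ρL' (subst (x ∈_) (sym ρL'≡L') (L⊆L' x x∈L))

module CopyFixing {N L : FinSet} {u : Elem} (u∉L : u ∉ L) (N∼uL : N ∼ (u ∷ L))
                  {M : FinSet} {φ : Elem → Elem} (φ-bij : IsBij φ N M)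
                  (N∩M⇔L : ∀ x → (x ∈ N × x ∈ M) ⇔ x ∈ L)
                  (φ-fixes-L : ∀ x → x ∈ L → φ x ≡ x) where

  v : Elem
  v = φ u

  φ-maps : ∀ x → x ∈ N → φ x ∈ M
  φ-maps = proj₁ φ-bij

  φ-injective : ∀ x y → x ∈ N → y ∈ N → φ x ≡ φ y → x ≡ y
  φ-injective = proj₁ (proj₂ φ-bij)

  φ-onto : ∀ y → y ∈ M → Σ Elem λ x → x ∈ N × φ x ≡ y
  φ-onto = proj₂ (proj₂ φ-bij)

  u∈N : u ∈ N
  u∈N = from (N∼uL u) (here refl)

  L⊆N : L ⊆ N
  L⊆N x x∈L = proj₁ (from (N∩M⇔L x) x∈L)

  L⊆M : L ⊆ M
  L⊆M x x∈L = proj₂ (from (N∩M⇔L x) x∈L)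

  v∈M : v ∈ M
  v∈M = φ-maps u u∈N

  u∉M : u ∉ M
  u∉M u∈M = u∉L (to (N∩M⇔L u) (u∈N , u∈M))

  u≢v : u ≢ v
  u≢v u≡v = u∉M (subst (_∈ M) (sym u≡v) v∈M)

  v∉L : v ∉ L
  v∉L v∈L = u≢v (φ-injective u v u∈N (L⊆N v v∈L) (sym (φ-fixes-L v v∈L)))

  v∉N : v ∉ N
  v∉N v∈N = v∉L (to (N∩M⇔L v) (v∈N , v∈M))

  N-cases : ∀ {x} → x ∈ N → x ≡ u ⊎ x ∈ L
  N-cases {x} x∈N with to (N∼uL x) x∈N
  ... | here x≡u = inj₁ x≡u
  ... | there x∈L = inj₂ x∈L

  M-cases : ∀ {y} → y ∈ M → y ≡ v ⊎ y ∈ L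
  M-cases {y} y∈M with φ-onto y y∈M
  ... | x , x∈N , refl with N-cases x∈N
  ...   | inj₁ refl = inj₁ refl
  ...   | inj₂ x∈L = inj₂ (subst (_∈ L) (sym (φ-fixes-L x x∈L)) x∈L)

  M∼vL : M ∼ (v ∷ L)
  M∼vL y = mk⇔ (λ y∈M → [ here , there ]′ (M-cases y∈M)) back
    where
    back : y ∈ v ∷ L → y ∈ M
    back (here refl) = v∈M
    back (there y∈L) = L⊆M y y∈L

  ρ-fixes-N : ∀ x → x ∈ N → ρ u v x ≡ x
  ρ-fixes-N x = v∉A⇒ρ-id-on u v∉N

  ρ∘φ≡id : ∀ x → x ∈ N → ρ u v (φ x) ≡ x
  ρ∘φ≡id x x∈N with N-cases x∈N
  ... | inj₁ refl = ρ-v≡u u v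
  ... | inj₂ x∈L = trans (cong (ρ u v) (φ-fixes-L x x∈L)) (v∉A⇒ρ-id-on u v∉L x∈L)

  φ∘ρ≡id : ∀ y → y ∈ M → φ (ρ u v y) ≡ y
  φ∘ρ≡id y y∈M with M-cases y∈M
  ... | inj₁ refl = cong φ (ρ-v≡u u v)
  ... | inj₂ y∈L = trans (cong φ (v∉A⇒ρ-id-on u v∉L y∈L)) (φ-fixes-L y y∈L)

  N∖M⊆u : (N ∖ M) ⊆ (u ∷ [])
  N∖M⊆u = ∖-⊆-singleton N-cases L⊆M

  M∖N⊆v : (M ∖ N) ⊆ (v ∷ [])
  M∖N⊆v = ∖-⊆-singleton M-cases L⊆N

lemma4p16 : (𝔽 : CIFrame) → ClosedUnderCopying 𝔽 → ClosedUnderMarginalization 𝔽 →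
            ClosedUnderTightReplication 𝔽 →
            ∀ (N L : FinSet) (u : Elem) → u ∉ L → N ∼ (u ∷ L) →
            ∀ 𝓜 → 𝔉 𝔽 N 𝓜 → SelfAdhesiveAt 𝔽 N 𝓜 L
lemma4p16 𝔽 _ _ closed-under-TR N L u u∉L N∼uL 𝓜 𝓜∈𝔉N M φ φ-bij N∩M⇔L φ-fixes-L =
  𝓩 , closed-under-TR N M L u v u∉L v∉L u≢v N∼uL M∼vL 𝓜 𝓜∈𝔉N , 𝓩↓N≐𝓜 , 𝓩↓M≐φ𝓜 , N∖M⊥M∖N
  where
  open CopyFixing u∉L N∼uL φ-bij N∩M⇔L φ-fixes-L

  𝓜-over-N : IsModelOver N 𝓜
  𝓜-over-N = models 𝔽 N 𝓜 𝓜∈𝔉N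

  𝓩 : Model
  𝓩 = replicate (N ++ M) L u v 𝓜

  𝓩↓N≐𝓜 : (𝓩 ↓ N) ≐ 𝓜
  𝓩↓N≐𝓜 = ≐-trans (replicate↓≐copy 𝓜-over-N (λ _ → ∈-++⁺ˡ) (λ _ → id) ρ-fixes-N ρ-fixes-N)
                   (copy-id (proj₂ 𝓜-over-N))

  𝓩↓M≐φ𝓜 : (𝓩 ↓ M) ≐ copy φ 𝓜
  𝓩↓M≐φ𝓜 = replicate↓≐copy 𝓜-over-N (λ _ → ∈-++⁺ʳ N) φ-maps ρ∘φ≡id φ∘ρ≡id

  N∖M⊥M∖N : Indep 𝓩 (N ∖ M) (M ∖ N) L
  N∖M⊥M∖N = Indep-antimono N∖M⊆u M∖N⊆v (Indep-singleton
    (replicate-u⊥v (∈-++⁺ˡ u∈N) (∈-++⁺ʳ N v∈M) u≢v u∉L v∉L (λ x x∈L → ∈-++⁺ˡ (L⊆N x x∈L))))
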